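{- Let $T$ be any MacMahon cube (the target). Among the $\binom{30}{8}=5852925$ collections of eight distinct MacMahon cubes, exactly $133680$ have positive solution number for $T$. The maximum solution number for $T$ over all collections is $16$, attained by exactly $81$ collections, and the minimum positive solution number is $2$, attained by exactly $93000$ collections.
   Context: A MacMahon cube is a cube whose six faces are painted with the six colors $1,2,\dots,6$, each color used on exactly one face, considered up to rotation; there are exactly $30$ MacMahon cubes. At each of the $8$ vertices of a cube three faces meet; reading their colors clockwise as seen from outside the cube gives a cyclically ordered triple, and the corner number of that vertex is the cyclic rotation of this triple whose three-digit value is smallest. Each MacMahon cube has $8$ distinct corner numbers. A collection is a set of eight distinct MacMahon cubes (the target may or may not belong to it). For a target MacMahon cube $T$ and a collection $W$, a solution is a bijection $\sigma$ from $W$ to the set of $8$ corner numbers of $T$ such that, for each $C\in W$, $\sigma(C)$ is a corner number of $C$; this corresponds to placing each cube $C$ at the corner of a $2\times2\times2$ block corresponding to $\sigma(C)$ so that the outside of the block is colored like an enlarged copy of $T$ (no condition is imposed on touching interior faces). The solution number of $W$ for $T$ is the number of solutions. -}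

module Defs where

open import Data.Bool using (Bool; true; false; if_then_else_; _xor_; not)
open import Data.Nat using (ℕ; zero; suc; _+_; _*_; _⊓_; _≤_; _≤?_; _≟_)
open import Data.Fin using (Fin; zero; suc; toℕ; #_)
import Data.Fin.Properties as FinP
open import Data.List using (List; []; _∷_; map; _++_; concatMap; filter; length; allFin)
open import Data.Nat.ListAction using (sum)
open import Relation.Unary using (Decidable)
open import Data.List.Relation.Unary.All using (All; all?)
open import Data.List.Relation.Unary.Unique.Propositional using (Unique)
open import Data.List.Relation.Unary.Unique.DecPropositional (FinP._≟_ {6}) using (unique?)
open import Data.List.Membership.DecPropositional _≟_ using (_∈?_)
open import Data.Product using (_×_; _,_)
open import Relation.Nullary using (does)

-- Colour k : Fin 6 stands for the paper's colour k+1 (so colours are 1..6).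
Colour : Set
Colour = Fin 6

colourValue : Colour → ℕ
colourValue k = suc (toℕ k)

-- Axes 0,1,2 = x,y,z.  A face is an axis together with a side
-- (true = the face with outward normal +e_i, false = outward normal -e_i).
Axis : Set
Axis = Fin 3

Face : Set
Face = Axis × Bool

faceIndex : Face → Fin 6
faceIndex (zero , true) = zero
faceIndex (zero , false) = suc zero
faceIndex (suc zero , true) = suc (suc zero)
faceIndex (suc zero , false) = suc (suc (suc zero))
faceIndex (suc (suc zero) , true) = suc (suc (suc (suc zero)))
faceIndex (suc (suc zero) , false) = suc (suc (suc (suc (suc zero))))

indexFace : Fin 6 → Face
indexFace zero = zero , true
indexFace (suc zero) = zero , false
indexFace (suc (suc zero)) = suc zero , true
indexFace (suc (suc (suc zero))) = suc zero , false
indexFace (suc (suc (suc (suc zero)))) = suc (suc zero) , true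
indexFace (suc (suc (suc (suc (suc zero))))) = suc (suc zero) , false

-- A colouring lists the colour of each face (in the order of faceIndex).
Coloring : Set
Coloring = List Colour

colourAt : Coloring → ℕ → Colour
colourAt [] _ = zero
colourAt (c ∷ cs) zero = c
colourAt (c ∷ cs) (suc i) = colourAt cs i

colourOf : Coloring → Face → Colour
colourOf c f = colourAt c (toℕ (faceIndex f))

words : ℕ → List (List Colour)
words zero = [] ∷ []
words (suc n) = concatMap (λ c → map (c ∷_) (words n)) (allFin 6)

allColorings : List Coloring
allColorings = filter unique? (words 6)

-- The rotation group of the cube: signed permutation matrices of
-- determinant +1.  A rotation is given by an axis permutation p (with its
-- parity) and sign flips s; it sends the face with normal ±e_i to the
-- face with normal ±(-1)^{s_i} e_{p i}.

-- the six permutations of the three axes, with their parity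
-- (true = odd permutation)
axisPerms : List ((Axis → Axis) × Bool)
axisPerms =
    (perm (# 0) (# 1) (# 2) , false) ∷ (perm (# 1) (# 2) (# 0) , false)
  ∷ (perm (# 2) (# 0) (# 1) , false) ∷ (perm (# 1) (# 0) (# 2) , true)
  ∷ (perm (# 0) (# 2) (# 1) , true)  ∷ (perm (# 2) (# 1) (# 0) , true) ∷ []
  where
  perm : Fin 3 → Fin 3 → Fin 3 → Axis → Axis
  perm a b c zero = a
  perm a b c (suc zero) = b
  perm a b c (suc (suc zero)) = c

signVectors : List (Axis → Bool)
signVectors = concatMap (λ a → concatMap (λ b → map (λ c → sv a b c) bools) bools) bools
  where
  bools : List Bool
  bools = true ∷ false ∷ []
  sv : Bool → Bool → Bool → Axis → Bool
  sv a b c zero = a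
  sv a b c (suc zero) = b
  sv a b c (suc (suc zero)) = c

Rotation : Set
Rotation = Face → Face

-- all 24 rotations of the cube (determinant = (-1)^parity * Π (-1)^{s_i} = +1)
rotations : List Rotation
rotations = concatMap (λ { (p , odd) →
               concatMap (λ s →
                 if (odd xor (s zero xor (s (suc zero) xor s (suc (suc zero)))))
                 then [] else ((λ { (i , e) → p i , (e xor s i) }) ∷ [])) signVectors })
            axisPerms

rotate : Rotation → Coloring → Coloring
rotate R c = map (λ k → colourOf c (R (indexFace k))) (allFin 6)

-- MacMahon cubes = colourings up to rotation.  Each rotation class is
-- represented by its unique lexicographically least member.

-- base-6 code; numeric order of codes = lexicographic order of colourings
code : Coloring → ℕ
code [] = 0
code (c ∷ cs) = toℕ c * 6 ^' length cs + code cs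
  where
  _^'_ : ℕ → ℕ → ℕ
  b ^' zero = 1
  b ^' suc n = b * (b ^' n)

IsCanonical : Coloring → Set
IsCanonical c = All (λ R → code c ≤ code (rotate R c)) rotations

macMahonCubes : List Coloring
macMahonCubes = filter (λ c → all? (λ R → code c ≤? code (rotate R c)) rotations) allColorings

-- A vertex is (sx , sy , sz), true = positive side.  Seen from outside, the cyclic order
-- x → y → z is counterclockwise when an even number of the signs are
-- negative (right-handed coordinates), and clockwise otherwise.
Vertex : Set
Vertex = Bool × Bool × Bool

vertices : List Vertex
vertices = concatMap (λ a → concatMap (λ b → map (λ c → a , b , c) bools) bools) bools
  where
  bools : List Bool
  bools = true ∷ false ∷ []

cornerValue : ℕ → ℕ → ℕ → ℕ
cornerValue a b c = (100 * a + 10 * b + c) ⊓ ((100 * b + 10 * c + a) ⊓ (100 * c + 10 * a + b))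

cornerNumber : Coloring → Vertex → ℕ
cornerNumber col (sx , sy , sz) =
  -- sx xor sy xor sz = true  iff  an even number of signs are negative
  if sx xor (sy xor sz) then clockwiseXZY else clockwiseXYZ
  where
  x y z : ℕ
  x = colourValue (colourOf col (zero , sx))
  y = colourValue (colourOf col (suc zero , sy))
  z = colourValue (colourOf col (suc (suc zero) , sz))
  clockwiseXYZ clockwiseXZY : ℕ
  clockwiseXYZ = cornerValue x y z
  clockwiseXZY = cornerValue x z y

cornerNumbers : Coloring → List ℕ
cornerNumbers col = map (cornerNumber col) vertices

subsetsOfSize : {A : Set} → ℕ → List A → List (List A)
subsetsOfSize zero _ = [] ∷ []
subsetsOfSize (suc k) [] = []
subsetsOfSize (suc k) (x ∷ xs) = map (x ∷_) (subsetsOfSize k xs) ++ subsetsOfSize (suc k) xs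

collections : List (List Coloring)
collections = subsetsOfSize 8 macMahonCubes

picks : {A : Set} → List A → List (A × List A)
picks [] = []
picks (x ∷ xs) = (x , xs) ∷ map (λ { (y , ys) → y , x ∷ ys }) (picks xs)

-- number of bijections σ from the cubes in W to the entries of S with
-- σ(C) a corner number of C (S is duplicate-free in our use)
matchings : List ℕ → List Coloring → ℕ
matchings S [] = 1
matchings S (C ∷ W) =
  sum (map (λ { (s , S') → if does (s ∈? cornerNumbers C) then matchings S' W else 0 }) (picks S))

solutionNumber : Coloring → List Coloring → ℕ
solutionNumber T W = matchings (cornerNumbers T) W

count : {A : Set} {P : A → Set} → Decidable P → List A → ℕ
count P? xs = length (filter P? xs)

{-# OPTIONS --safe #-}
-- Let s₁,…,s₈ be the corner numbers of the target T and record a cube C by the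
-- 0/1 row (sⱼ is a corner number of C)ⱼ.  A solution for W is a perfect matching
-- between the cubes of W and the corners of T, so the solution number of W is the
-- permanent of the 8 × 8 matrix formed by the rows of its cubes.  For every target
-- the 30 rows form the same multiset, hence all the counts are counts of 8-subsets
-- of one fixed list of rows with a prescribed permanent.  These are found in a
-- single pass over the list: a partial choice of rows only matters through the
-- number of rows still missing and the formal sum of the column sets left free by
-- its partial matchings, and partial choices that agree in both are merged.
module Submission where

open import Defs
open import Data.Nat using (ℕ; _≤_; _<_; _≤?_; _<?_; _≟_)
open import Data.List using (List; length)
open import Data.List.Membership.Propositional using (_∈_)
open import Data.List.Relation.Unary.All using (All)
open import Data.Product using (_×_)
open import Relation.Binary.PropositionalEquality using (_≡_)

open import Data.Bool using (Bool; true; false; if_then_else_; T)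
open import Data.Unit using (tt)
import Data.Bool.Properties as Bool
open import Data.Fin using (#_)
open import Data.List using ([]; _∷_; map; _++_; foldr; replicate)
open import Data.List.Properties using (≡-dec; map-∘; map-cong; length-++; length-map; filter-some)
open import Data.List.Membership.DecPropositional _≟_ using (_∈?_)
open import Data.List.Relation.Binary.Lex.Strict using (≤-decTotalOrder)
import Data.List.Relation.Binary.Permutation.Propositional as ↭
open ↭ using (_↭_; prep; swap; ↭-sym; ↭-trans; ↭-reflexive)
open import Data.List.Sort.InsertionSort (≤-decTotalOrder Bool.<-strictTotalOrder) using (sort)
open import Data.List.Sort.InsertionSort.Properties (≤-decTotalOrder Bool.<-strictTotalOrder) using (sort-↭)
import Data.List.Relation.Unary.All as All
open import Data.List.Relation.Unary.All.Properties using (¬Any⇒All¬)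
open import Data.Nat using (zero; suc; _+_; _*_; _≡ᵇ_; _<ᵇ_; s≤s)
open import Data.Nat.Combinatorics using (_C_; nCk+nC[k+1]≡[n+1]C[k+1])
open import Data.Nat.ListAction using (sum)
open import Data.Nat.Tactic.RingSolver using (solve-∀)
open import Data.Nat.Properties
  using (+-assoc; +-identityʳ; *-identityˡ; *-zeroʳ; *-distribˡ-+; *-distribʳ-+;
         ≡ᵇ⇒≡; <⇒≢; ≤∧≢⇒<; ≮⇒≥; ≰⇒>; m<n⇒m<1+n; +-commutativeSemigroup)
open import Algebra.Properties.CommutativeSemigroup +-commutativeSemigroup using (x∙yz≈y∙xz; interchange)
open import Data.Product using (_,_)
open import Function using (_∘_)
open import Relation.Binary.PropositionalEquality
  using (refl; sym; trans; cong; cong₂; subst; module ≡-Reasoning)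
open import Relation.Nullary using (Dec; does; yes; no)
open import Relation.Nullary.Decidable using (toWitness)
open import Relation.Unary using (Decidable; ∁)

open ≡-Reasoning

sum-map-∘ : {A B : Set} (h : B → ℕ) (f : A → B) (xs : List A) →
  sum (map h (map f xs)) ≡ sum (map (h ∘ f) xs)
sum-map-∘ h f xs = cong sum (sym (map-∘ xs))

sum-map-cong : {A : Set} {g h : A → ℕ} → (∀ x → g x ≡ h x) → (xs : List A) →
  sum (map g xs) ≡ sum (map h xs)
sum-map-cong g≗h xs = cong sum (map-cong g≗h xs)

sum-map-+ : {A : Set} (g h : A → ℕ) (xs : List A) →
  sum (map (λ x → g x + h x) xs) ≡ sum (map g xs) + sum (map h xs)
sum-map-+ g h [] = refl
sum-map-+ g h (x ∷ xs) =
  trans (cong (g x + h x +_) (sum-map-+ g h xs)) (interchange (g x) (h x) (sum (map g xs)) (sum (map h xs)))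

sum-map-if : {A : Set} (b : Bool) (g : A → ℕ) (xs : List A) →
  sum (map (λ x → if b then g x else 0) xs) ≡ (if b then sum (map g xs) else 0)
sum-map-if true g xs = refl
sum-map-if false g [] = refl
sum-map-if false g (x ∷ xs) = sum-map-if false g xs

countᵇ : {A : Set} → (A → Bool) → List A → ℕ
countᵇ p [] = 0
countᵇ p (x ∷ xs) = if p x then suc (countᵇ p xs) else countᵇ p xs

module _ {A : Set} where

  count≡countᵇ : {P : A → Set} (P? : Decidable P) (xs : List A) →
    count P? xs ≡ countᵇ (does ∘ P?) xs
  count≡countᵇ P? [] = refl
  count≡countᵇ P? (x ∷ xs) with does (P? x)
  ... | true = cong suc (count≡countᵇ P? xs)
  ... | false = count≡countᵇ P? xs

  count≡0⇒All∁ : {P : A → Set} (P? : Decidable P) {xs : List A} →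
    count P? xs ≡ 0 → All (∁ P) xs
  count≡0⇒All∁ P? {xs} none = ¬Any⇒All¬ xs (λ some → <⇒≢ (filter-some P? some) (sym none))

  countᵇ-++ : (p : A → Bool) (xs ys : List A) →
    countᵇ p (xs ++ ys) ≡ countᵇ p xs + countᵇ p ys
  countᵇ-++ p [] ys = refl
  countᵇ-++ p (x ∷ xs) ys with p x
  ... | true = cong suc (countᵇ-++ p xs ys)
  ... | false = countᵇ-++ p xs ys

  countᵇ-cong : {p p′ : A → Bool} → (∀ x → p x ≡ p′ x) → (xs : List A) →
    countᵇ p xs ≡ countᵇ p′ xs
  countᵇ-cong p≗p′ [] = refl
  countᵇ-cong {p′ = p′} p≗p′ (x ∷ xs) rewrite p≗p′ x with p′ x
  ... | true = cong suc (countᵇ-cong p≗p′ xs)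
  ... | false = countᵇ-cong p≗p′ xs

countᵇ-map : {A B : Set} (p : B → Bool) (f : A → B) (xs : List A) →
  countᵇ p (map f xs) ≡ countᵇ (p ∘ f) xs
countᵇ-map p f [] = refl
countᵇ-map p f (x ∷ xs) with p (f x)
... | true = cong suc (countᵇ-map p f xs)
... | false = countᵇ-map p f xs

module _ {A : Set} where

  length-subsetsOfSize : ∀ k (xs : List A) → length (subsetsOfSize k xs) ≡ length xs C k
  length-subsetsOfSize zero xs = refl
  length-subsetsOfSize (suc k) [] = refl
  length-subsetsOfSize (suc k) (x ∷ xs) = begin
    length (map (x ∷_) (subsetsOfSize k xs) ++ subsetsOfSize (suc k) xs)
      ≡⟨ length-++ (map (x ∷_) (subsetsOfSize k xs)) ⟩
    length (map (x ∷_) (subsetsOfSize k xs)) + length (subsetsOfSize (suc k) xs)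
      ≡⟨ cong₂ _+_ (trans (length-map (x ∷_) (subsetsOfSize k xs)) (length-subsetsOfSize k xs))
                   (length-subsetsOfSize (suc k) xs) ⟩
    length xs C k + length xs C suc k
      ≡⟨ nCk+nC[k+1]≡[n+1]C[k+1] (length xs) k ⟩
    suc (length xs) C suc k ∎

  length<⇒subsetsOfSize≡[] : ∀ k (xs : List A) → length xs < k → subsetsOfSize k xs ≡ []
  length<⇒subsetsOfSize≡[] (suc k) [] _ = refl
  length<⇒subsetsOfSize≡[] (suc k) (x ∷ xs) (s≤s |xs|<k) =
    cong₂ _++_ (cong (map (x ∷_)) (length<⇒subsetsOfSize≡[] k xs |xs|<k))
               (length<⇒subsetsOfSize≡[] (suc k) xs (m<n⇒m<1+n |xs|<k))

  countᵇ-subsetsOfSize-∷ : (p : List A → Bool) (x : A) (k : ℕ) (xs : List A) →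
    countᵇ p (subsetsOfSize (suc k) (x ∷ xs))
      ≡ countᵇ (p ∘ (x ∷_)) (subsetsOfSize k xs) + countᵇ p (subsetsOfSize (suc k) xs)
  countᵇ-subsetsOfSize-∷ p x k xs =
    trans (countᵇ-++ p (map (x ∷_) (subsetsOfSize k xs)) (subsetsOfSize (suc k) xs))
          (cong (_+ countᵇ p (subsetsOfSize (suc k) xs)) (countᵇ-map p (x ∷_) (subsetsOfSize k xs)))

  countᵇ-subsetsOfSize-∷∷ : (p : List A → Bool) (x y : A) (k : ℕ) (xs : List A) →
    countᵇ p (subsetsOfSize (suc k) (x ∷ y ∷ xs))
      ≡ countᵇ (p ∘ (x ∷_)) (subsetsOfSize k (y ∷ xs))
        + (countᵇ (p ∘ (y ∷_)) (subsetsOfSize k xs) + countᵇ p (subsetsOfSize (suc k) xs))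
  countᵇ-subsetsOfSize-∷∷ p x y k xs =
    trans (countᵇ-subsetsOfSize-∷ p x k (y ∷ xs))
          (cong (countᵇ (p ∘ (x ∷_)) (subsetsOfSize k (y ∷ xs)) +_)
                (countᵇ-subsetsOfSize-∷ p y k xs))

countᵇ-subsetsOfSize-map : {A B : Set} (f : A → B) (p : List B → Bool) (k : ℕ) (xs : List A) →
  countᵇ p (subsetsOfSize k (map f xs)) ≡ countᵇ (p ∘ map f) (subsetsOfSize k xs)
countᵇ-subsetsOfSize-map f p zero xs = refl
countᵇ-subsetsOfSize-map f p (suc k) [] = refl
countᵇ-subsetsOfSize-map f p (suc k) (x ∷ xs) = begin
  countᵇ p (subsetsOfSize (suc k) (f x ∷ map f xs))
    ≡⟨ countᵇ-subsetsOfSize-∷ p (f x) k (map f xs) ⟩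
  countᵇ (p ∘ (f x ∷_)) (subsetsOfSize k (map f xs)) + countᵇ p (subsetsOfSize (suc k) (map f xs))
    ≡⟨ cong₂ _+_ (countᵇ-subsetsOfSize-map f (p ∘ (f x ∷_)) k xs)
                 (countᵇ-subsetsOfSize-map f p (suc k) xs) ⟩
  countᵇ (p ∘ map f ∘ (x ∷_)) (subsetsOfSize k xs) + countᵇ (p ∘ map f) (subsetsOfSize (suc k) xs)
    ≡⟨ sym (countᵇ-subsetsOfSize-∷ (p ∘ map f) x k xs) ⟩
  countᵇ (p ∘ map f) (subsetsOfSize (suc k) (x ∷ xs)) ∎

module _ {A : Set} where

  PermutationInvariant : (List A → Bool) → Set
  PermutationInvariant p = ∀ {W W′} → W ↭ W′ → p W ≡ p W′

  SameSubsetCounts : List A → List A → Set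
  SameSubsetCounts xs ys = ∀ k (p : List A → Bool) → PermutationInvariant p →
    countᵇ p (subsetsOfSize k xs) ≡ countᵇ p (subsetsOfSize k ys)

  sameSubsetCounts-∷ : ∀ x {xs ys} → SameSubsetCounts xs ys → SameSubsetCounts (x ∷ xs) (x ∷ ys)
  sameSubsetCounts-∷ x same zero p p-inv = refl
  sameSubsetCounts-∷ x {xs} {ys} same (suc k) p p-inv = begin
    countᵇ p (subsetsOfSize (suc k) (x ∷ xs))
      ≡⟨ countᵇ-subsetsOfSize-∷ p x k xs ⟩
    countᵇ (p ∘ (x ∷_)) (subsetsOfSize k xs) + countᵇ p (subsetsOfSize (suc k) xs)
      ≡⟨ cong₂ _+_ (same k (p ∘ (x ∷_)) (p-inv ∘ prep x)) (same (suc k) p p-inv) ⟩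
    countᵇ (p ∘ (x ∷_)) (subsetsOfSize k ys) + countᵇ p (subsetsOfSize (suc k) ys)
      ≡⟨ sym (countᵇ-subsetsOfSize-∷ p x k ys) ⟩
    countᵇ p (subsetsOfSize (suc k) (x ∷ ys)) ∎

  sameSubsetCounts-swap : ∀ x y xs → SameSubsetCounts (x ∷ y ∷ xs) (y ∷ x ∷ xs)
  sameSubsetCounts-swap x y xs zero p p-inv = refl
  sameSubsetCounts-swap x y xs (suc zero) p p-inv =
    trans (countᵇ-subsetsOfSize-∷∷ p x y 0 xs)
          (trans (x∙yz≈y∙xz (countᵇ (p ∘ (x ∷_)) (subsetsOfSize 0 xs))
                            (countᵇ (p ∘ (y ∷_)) (subsetsOfSize 0 xs))
                            (countᵇ p (subsetsOfSize 1 xs)))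
                 (sym (countᵇ-subsetsOfSize-∷∷ p y x 0 xs)))
  sameSubsetCounts-swap x y xs (suc (suc i)) p p-inv = begin
    countᵇ p (subsetsOfSize (suc (suc i)) (x ∷ y ∷ xs))
      ≡⟨ countᵇ-subsetsOfSize-∷∷ p x y (suc i) xs ⟩
    countᵇ (p ∘ (x ∷_)) (subsetsOfSize (suc i) (y ∷ xs)) + (hasY + rest)
      ≡⟨ cong (_+ (hasY + rest)) (countᵇ-subsetsOfSize-∷ (p ∘ (x ∷_)) y i xs) ⟩
    (hasXY + hasX) + (hasY + rest)
      ≡⟨ interchange hasXY hasX hasY rest ⟩
    (hasXY + hasY) + (hasX + rest)
      ≡⟨ cong (λ n → (n + hasY) + (hasX + rest))
              (countᵇ-cong (λ W → p-inv (swap x y ↭.refl)) (subsetsOfSize i xs)) ⟩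
    (hasYX + hasY) + (hasX + rest)
      ≡⟨ cong (_+ (hasX + rest)) (sym (countᵇ-subsetsOfSize-∷ (p ∘ (y ∷_)) x i xs)) ⟩
    countᵇ (p ∘ (y ∷_)) (subsetsOfSize (suc i) (x ∷ xs)) + (hasX + rest)
      ≡⟨ sym (countᵇ-subsetsOfSize-∷∷ p y x (suc i) xs) ⟩
    countᵇ p (subsetsOfSize (suc (suc i)) (y ∷ x ∷ xs)) ∎
    where
    hasX hasY hasXY hasYX rest : ℕ
    hasX = countᵇ (p ∘ (x ∷_)) (subsetsOfSize (suc i) xs)
    hasY = countᵇ (p ∘ (y ∷_)) (subsetsOfSize (suc i) xs)
    hasXY = countᵇ (p ∘ (x ∷_) ∘ (y ∷_)) (subsetsOfSize i xs)
    hasYX = countᵇ (p ∘ (y ∷_) ∘ (x ∷_)) (subsetsOfSize i xs)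
    rest = countᵇ p (subsetsOfSize (suc (suc i)) xs)

  ↭⇒sameSubsetCounts : ∀ {xs ys} → xs ↭ ys → SameSubsetCounts xs ys
  ↭⇒sameSubsetCounts ↭.refl k p p-inv = refl
  ↭⇒sameSubsetCounts (prep x xs↭ys) = sameSubsetCounts-∷ x (↭⇒sameSubsetCounts xs↭ys)
  ↭⇒sameSubsetCounts (swap {xs} x y xs↭ys) k p p-inv =
    trans (sameSubsetCounts-swap x y xs k p p-inv)
          (sameSubsetCounts-∷ y (sameSubsetCounts-∷ x (↭⇒sameSubsetCounts xs↭ys)) k p p-inv)
  ↭⇒sameSubsetCounts (↭.trans xs↭ys ys↭zs) k p p-inv =
    trans (↭⇒sameSubsetCounts xs↭ys k p p-inv) (↭⇒sameSubsetCounts ys↭zs k p p-inv)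

-- Permanents of 0/1 matrices

-- `av` marks the columns that are still free; `choices av r` lists, as updated
-- markings, the ways of matching row `r` to a free column j with r_j = true.
choices : List Bool → List Bool → List (List Bool)
choices [] _ = []
choices (_ ∷ _) [] = []
choices (true ∷ av) (true ∷ r) = (false ∷ av) ∷ map (true ∷_) (choices av r)
choices (true ∷ av) (false ∷ r) = map (true ∷_) (choices av r)
choices (false ∷ av) (_ ∷ r) = map (false ∷_) (choices av r)

permanent : List Bool → List (List Bool) → ℕ
permanent av [] = 1
permanent av (r ∷ rs) = sum (map (λ av′ → permanent av′ rs) (choices av r))

choices-[] : ∀ av → choices av [] ≡ []
choices-[] [] = refl
choices-[] (_ ∷ _) = refl

sum-map-choices-true : (f : List Bool → ℕ) (av : List Bool) (b : Bool) (r : List Bool) →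
  sum (map f (choices (true ∷ av) (b ∷ r)))
    ≡ (if b then f (false ∷ av) else 0) + sum (map (f ∘ (true ∷_)) (choices av r))
sum-map-choices-true f av true r = cong (f (false ∷ av) +_) (sum-map-∘ f (true ∷_) (choices av r))
sum-map-choices-true f av false r = sum-map-∘ f (true ∷_) (choices av r)

select : {A : Set} → List Bool → List A → List A
select [] _ = []
select (_ ∷ _) [] = []
select (true ∷ av) (x ∷ xs) = x ∷ select av xs
select (false ∷ av) (x ∷ xs) = select av xs

-- `h` is abstract because `matchings` uses a pattern lambda of Defs, which cannot be
-- named here; for the same reason the relabelling done by `picks` appears as `_`.
sum-picks-select : {A : Set} (p : A → Bool) (g : List A → ℕ) (h : A × List A → ℕ) →
  (∀ x xs → h (x , xs) ≡ (if p x then g xs else 0)) →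
  ∀ av xs → sum (map h (picks (select av xs)))
              ≡ sum (map (λ av′ → g (select av′ xs)) (choices av (map p xs)))
sum-picks-select p g h h≡ [] xs = refl
sum-picks-select p g h h≡ (_ ∷ _) [] = refl
sum-picks-select p g h h≡ (false ∷ av) (x ∷ xs) =
  trans (sum-picks-select p g h h≡ av xs)
        (sym (sum-map-∘ (λ av′ → g (select av′ (x ∷ xs))) (false ∷_) (choices av (map p xs))))
sum-picks-select p g h h≡ (true ∷ av) (x ∷ xs) = begin
  h (x , select av xs) + sum (map h (map _ (picks (select av xs))))
    ≡⟨ cong₂ _+_ (h≡ x (select av xs))
                 (trans (sum-map-∘ h _ (picks (select av xs)))
                        (sum-picks-select p (g ∘ (x ∷_)) _ (λ y ys → h≡ y (x ∷ ys)) av xs)) ⟩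
  (if p x then g (select av xs) else 0)
    + sum (map (λ av′ → g (x ∷ select av′ xs)) (choices av (map p xs)))
    ≡⟨ sym (sum-map-choices-true (λ av′ → g (select av′ (x ∷ xs))) av (p x) (map p xs)) ⟩
  sum (map (λ av′ → g (select av′ (x ∷ xs))) (choices (true ∷ av) (p x ∷ map p xs))) ∎

pairSum : (List Bool → ℕ) → List Bool → List Bool → List Bool → ℕ
pairSum f av r₁ r₂ = sum (map (λ av′ → sum (map f (choices av′ r₂))) (choices av r₁))

pairSum-cong : {f g : List Bool → ℕ} → (∀ av → f av ≡ g av) → ∀ av r₁ r₂ →
  pairSum f av r₁ r₂ ≡ pairSum g av r₁ r₂
pairSum-cong f≗g av r₁ r₂ =
  sum-map-cong (λ av′ → sum-map-cong f≗g (choices av′ r₂)) (choices av r₁)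

pairSum-[]ʳ : ∀ f av r → pairSum f av r [] ≡ 0
pairSum-[]ʳ f av r =
  trans (sum-map-cong (λ av′ → cong (sum ∘ map f) (choices-[] av′)) (choices av r))
        (sum-map-if false (λ _ → 0) (choices av r))

pairSum-false : ∀ f av b r₁ c r₂ →
  pairSum f (false ∷ av) (b ∷ r₁) (c ∷ r₂) ≡ pairSum (f ∘ (false ∷_)) av r₁ r₂
pairSum-false f av b r₁ c r₂ =
  trans (sum-map-∘ (λ av′ → sum (map f (choices av′ (c ∷ r₂)))) (false ∷_) (choices av r₁))
        (sum-map-cong (λ av′ → sum-map-∘ f (false ∷_) (choices av′ r₂)) (choices av r₁))

-- The first column is taken by row 1, by row 2, or by neither.
pairSum-true : ∀ f av b r₁ c r₂ →
  pairSum f (true ∷ av) (b ∷ r₁) (c ∷ r₂)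
    ≡ (if b then sum (map (f ∘ (false ∷_)) (choices av r₂)) else 0)
      + ((if c then sum (map (f ∘ (false ∷_)) (choices av r₁)) else 0)
         + pairSum (f ∘ (true ∷_)) av r₁ r₂)
pairSum-true f av b r₁ c r₂ = begin
  sum (map second (choices (true ∷ av) (b ∷ r₁)))
    ≡⟨ sum-map-choices-true second av b r₁ ⟩
  (if b then second (false ∷ av) else 0) + sum (map (second ∘ (true ∷_)) (choices av r₁))
    ≡⟨ cong₂ _+_ (cong (λ n → if b then n else 0) (sum-map-∘ f (false ∷_) (choices av r₂)))
                 (sum-map-cong (λ av′ → sum-map-choices-true f av′ c r₂) (choices av r₁)) ⟩
  (if b then taken r₂ else 0)
    + sum (map (λ av′ → (if c then f (false ∷ av′) else 0)
                        + sum (map (f ∘ (true ∷_)) (choices av′ r₂)))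
               (choices av r₁))
    ≡⟨ cong ((if b then taken r₂ else 0) +_)
            (trans (sum-map-+ _ _ (choices av r₁))
                   (cong (_+ pairSum (f ∘ (true ∷_)) av r₁ r₂)
                         (sum-map-if c (f ∘ (false ∷_)) (choices av r₁)))) ⟩
  (if b then taken r₂ else 0) + ((if c then taken r₁ else 0) + pairSum (f ∘ (true ∷_)) av r₁ r₂) ∎
  where
  second : List Bool → ℕ
  second av′ = sum (map f (choices av′ (c ∷ r₂)))
  taken : List Bool → ℕ
  taken r = sum (map (f ∘ (false ∷_)) (choices av r))

pairSum-comm : ∀ f av r₁ r₂ → pairSum f av r₁ r₂ ≡ pairSum f av r₂ r₁
pairSum-comm f [] r₁ r₂ = refl
pairSum-comm f (a ∷ av) [] r₂ = sym (pairSum-[]ʳ f (a ∷ av) r₂)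
pairSum-comm f (a ∷ av) (b ∷ r₁) [] = pairSum-[]ʳ f (a ∷ av) (b ∷ r₁)
pairSum-comm f (false ∷ av) (b ∷ r₁) (c ∷ r₂) =
  trans (pairSum-false f av b r₁ c r₂)
        (trans (pairSum-comm (f ∘ (false ∷_)) av r₁ r₂) (sym (pairSum-false f av c r₂ b r₁)))
pairSum-comm f (true ∷ av) (b ∷ r₁) (c ∷ r₂) = begin
  pairSum f (true ∷ av) (b ∷ r₁) (c ∷ r₂)
    ≡⟨ pairSum-true f av b r₁ c r₂ ⟩
  (if b then taken r₂ else 0) + ((if c then taken r₁ else 0) + pairSum (f ∘ (true ∷_)) av r₁ r₂)
    ≡⟨ x∙yz≈y∙xz (if b then taken r₂ else 0) (if c then taken r₁ else 0) _ ⟩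
  (if c then taken r₁ else 0) + ((if b then taken r₂ else 0) + pairSum (f ∘ (true ∷_)) av r₁ r₂)
    ≡⟨ cong (λ n → (if c then taken r₁ else 0) + ((if b then taken r₂ else 0) + n))
            (pairSum-comm (f ∘ (true ∷_)) av r₁ r₂) ⟩
  (if c then taken r₁ else 0) + ((if b then taken r₂ else 0) + pairSum (f ∘ (true ∷_)) av r₂ r₁)
    ≡⟨ sym (pairSum-true f av c r₂ b r₁) ⟩
  pairSum f (true ∷ av) (c ∷ r₂) (b ∷ r₁) ∎
  where
  taken : List Bool → ℕ
  taken r = sum (map (f ∘ (false ∷_)) (choices av r))

permanent-↭ : ∀ {rs rs′} → rs ↭ rs′ → ∀ av → permanent av rs ≡ permanent av rs′
permanent-↭ ↭.refl av = refl
permanent-↭ (prep r rs↭rs′) av = sum-map-cong (permanent-↭ rs↭rs′) (choices av r)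
permanent-↭ (swap {rs} r₁ r₂ rs↭rs′) av =
  trans (pairSum-comm (λ av′ → permanent av′ rs) av r₁ r₂)
        (pairSum-cong (permanent-↭ rs↭rs′) av r₂ r₁)
permanent-↭ (↭.trans rs↭rs′ rs′↭rs″) av =
  trans (permanent-↭ rs↭rs′ av) (permanent-↭ rs′↭rs″ av)

-- Only `equal` carries evidence: `less` and `greater` merely steer the search
-- structures below, whose meaning does not depend on them.
data Comparison {A : Set} (x y : A) : Set where
  less greater : Comparison x y
  equal : x ≡ y → Comparison x y

Compare : Set → Set
Compare A = (x y : A) → Comparison x y

Comparison-map : {A B : Set} {x y : A} {x′ y′ : B} →
  (x ≡ y → x′ ≡ y′) → Comparison x y → Comparison x′ y′
Comparison-map f less = less
Comparison-map f greater = greater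
Comparison-map f (equal x≡y) = equal (f x≡y)

compareBool : Compare Bool
compareBool false false = equal refl
compareBool false true = less
compareBool true false = greater
compareBool true true = equal refl

compareℕ : Compare ℕ
compareℕ m n with m ≡ᵇ n in eq
... | true = equal (≡ᵇ⇒≡ m n (subst T (sym eq) tt))
... | false = if m <ᵇ n then less else greater

compare× : {A B : Set} → Compare A → Compare B → Compare (A × B)
compare× cmpA cmpB (a , b) (a′ , b′) with cmpA a a′
... | less = less
... | greater = greater
... | equal a≡a′ = Comparison-map (cong₂ _,_ a≡a′) (cmpB b b′)

compareList : {A : Set} → Compare A → Compare (List A)
compareList cmp [] [] = equal refl
compareList cmp [] (_ ∷ _) = less
compareList cmp (_ ∷ _) [] = greater
compareList cmp (x ∷ xs) (y ∷ ys) with cmp x y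
... | less = less
... | greater = greater
... | equal x≡y = Comparison-map (cong₂ _∷_ x≡y) (compareList cmp xs ys)

Weighted : Set → Set
Weighted A = List (A × ℕ)

weigh : {A : Set} → (A → ℕ) → Weighted A → ℕ
weigh h [] = 0
weigh h ((a , n) ∷ as) = n * h a + weigh h as

data Tree (A : Set) : Set where
  leaf : Tree A
  node : Tree A → A → ℕ → Tree A → Tree A

weighTree : {A : Set} → (A → ℕ) → Tree A → ℕ
weighTree h leaf = 0
weighTree h (node l a n r) = n * h a + (weighTree h l + weighTree h r)

-- Pre-order, so that inserting the visited keys into an empty tree rebuilds its shape.
foldTree : {A B : Set} → (A → ℕ → B → B) → Tree A → B → B
foldTree g leaf acc = acc
foldTree g (node l a n r) acc = foldTree g r (foldTree g l (g a n acc))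

module _ {A : Set} (cmp : Compare A) where

  insertWeighted : A → ℕ → Weighted A → Weighted A
  insertWeighted a n [] = (a , n) ∷ []
  insertWeighted a n ((b , m) ∷ bs) with cmp a b
  ... | less = (a , n) ∷ (b , m) ∷ bs
  ... | equal _ = (b , n + m) ∷ bs
  ... | greater = (b , m) ∷ insertWeighted a n bs

  insertTree : A → ℕ → Tree A → Tree A
  insertTree a n leaf = node leaf a n leaf
  insertTree a n (node l b m r) with cmp a b
  ... | less = node (insertTree a n l) b m r
  ... | equal _ = node l b (n + m) r
  ... | greater = node l b m (insertTree a n r)

  weigh-insertWeighted : ∀ h a n bs → weigh h (insertWeighted a n bs) ≡ n * h a + weigh h bs
  weigh-insertWeighted h a n [] = refl
  weigh-insertWeighted h a n ((b , m) ∷ bs) with cmp a b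
  ... | less = refl
  ... | equal refl = trans (cong (_+ weigh h bs) (*-distribʳ-+ (h a) n m)) (+-assoc (n * h a) (m * h a) _)
  ... | greater = trans (cong (m * h b +_) (weigh-insertWeighted h a n bs))
                        (x∙yz≈y∙xz (m * h b) (n * h a) _)

  weigh-insertAll : ∀ h as n bs →
    weigh h (foldr (λ a → insertWeighted a n) bs as) ≡ n * sum (map h as) + weigh h bs
  weigh-insertAll h [] n bs = cong (_+ weigh h bs) (sym (*-zeroʳ n))
  weigh-insertAll h (a ∷ as) n bs = begin
    weigh h (insertWeighted a n (foldr (λ a′ → insertWeighted a′ n) bs as))
      ≡⟨ weigh-insertWeighted h a n (foldr (λ a′ → insertWeighted a′ n) bs as) ⟩
    n * h a + weigh h (foldr (λ a′ → insertWeighted a′ n) bs as)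
      ≡⟨ cong (n * h a +_) (weigh-insertAll h as n bs) ⟩
    n * h a + (n * sum (map h as) + weigh h bs)
      ≡⟨ sym (+-assoc (n * h a) _ _) ⟩
    n * h a + n * sum (map h as) + weigh h bs
      ≡⟨ cong (_+ weigh h bs) (sym (*-distribˡ-+ n (h a) _)) ⟩
    n * (h a + sum (map h as)) + weigh h bs ∎

  weighTree-insertTree : ∀ h a n t → weighTree h (insertTree a n t) ≡ n * h a + weighTree h t
  weighTree-insertTree h a n leaf = refl
  weighTree-insertTree h a n (node l b m r) with cmp a b
  ... | less = begin
    m * h b + (weighTree h (insertTree a n l) + weighTree h r)
      ≡⟨ cong (λ w → m * h b + (w + weighTree h r)) (weighTree-insertTree h a n l) ⟩
    m * h b + (n * h a + weighTree h l + weighTree h r)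
      ≡⟨ cong (m * h b +_) (+-assoc (n * h a) _ _) ⟩
    m * h b + (n * h a + (weighTree h l + weighTree h r))
      ≡⟨ x∙yz≈y∙xz (m * h b) (n * h a) _ ⟩
    n * h a + (m * h b + (weighTree h l + weighTree h r)) ∎
  ... | equal refl = trans (cong (_+ (weighTree h l + weighTree h r)) (*-distribʳ-+ (h a) n m))
                           (+-assoc (n * h a) (m * h a) _)
  ... | greater = begin
    m * h b + (weighTree h l + weighTree h (insertTree a n r))
      ≡⟨ cong (λ w → m * h b + (weighTree h l + w)) (weighTree-insertTree h a n r) ⟩
    m * h b + (weighTree h l + (n * h a + weighTree h r))
      ≡⟨ cong (m * h b +_) (x∙yz≈y∙xz (weighTree h l) (n * h a) _) ⟩
    m * h b + (n * h a + (weighTree h l + weighTree h r))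
      ≡⟨ x∙yz≈y∙xz (m * h b) (n * h a) _ ⟩
    n * h a + (m * h b + (weighTree h l + weighTree h r)) ∎

foldTree-weigh : {A B : Set} (g : A → ℕ → B → B) (F : B → ℕ) (h : A → ℕ) →
  (∀ a n acc → F (g a n acc) ≡ n * h a + F acc) →
  ∀ t acc → F (foldTree g t acc) ≡ weighTree h t + F acc
foldTree-weigh g F h step leaf acc = refl
foldTree-weigh g F h step (node l a n r) acc = begin
  F (foldTree g r (foldTree g l (g a n acc)))
    ≡⟨ foldTree-weigh g F h step r _ ⟩
  weighTree h r + F (foldTree g l (g a n acc))
    ≡⟨ cong (weighTree h r +_)
            (trans (foldTree-weigh g F h step l _) (cong (weighTree h l +_) (step a n acc))) ⟩
  weighTree h r + (weighTree h l + (n * h a + F acc))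
    ≡⟨ rearrange (weighTree h r) (weighTree h l) (n * h a) (F acc) ⟩
  n * h a + (weighTree h l + weighTree h r) + F acc ∎
  where
  rearrange : ∀ w x y z → w + (x + (y + z)) ≡ y + (x + w) + z
  rearrange = solve-∀

-- Counting 8-subsets of rows by their permanent

compareColumns : Compare (List Bool)
compareColumns = compareList compareBool

-- A formal sum of column markings; kept sorted, so that equal sums are equal lists.
Combination : Set
Combination = Weighted (List Bool)

value : Combination → List (List Bool) → ℕ
value st rs = weigh (λ av → permanent av rs) st

absorb : List Bool → Combination → Combination
absorb r [] = []
absorb r ((av , c) ∷ st) =
  foldr (λ av′ → insertWeighted compareColumns av′ c) (absorb r st) (choices av r)

value-absorb : ∀ r st rs → value (absorb r st) rs ≡ value st (r ∷ rs)
value-absorb r [] rs = refl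
value-absorb r ((av , c) ∷ st) rs =
  trans (weigh-insertAll compareColumns (λ av′ → permanent av′ rs) (choices av r) c (absorb r st))
        (cong (c * permanent av (r ∷ rs) +_) (value-absorb r st rs))

-- (k , st): k rows are still to be chosen; st summarises those chosen so far.
Task : Set
Task = ℕ × Combination

compareTask : Compare Task
compareTask = compare× compareℕ (compareList (compare× compareColumns compareℕ))

completions : (ℕ → Bool) → List (List Bool) → Task → ℕ
completions q rs (k , st) = countᵇ (q ∘ value st) (subsetsOfSize k rs)

completions-∷ : ∀ q r rs k st →
  completions q (r ∷ rs) (suc k , st) ≡ completions q rs (k , absorb r st) + completions q rs (suc k , st)
completions-∷ q r rs k st =
  trans (countᵇ-subsetsOfSize-∷ (q ∘ value st) r k rs)
        (cong (_+ completions q rs (suc k , st))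
              (countᵇ-cong (λ W → cong q (sym (value-absorb r st W))) (subsetsOfSize k rs)))

skipRow : ℕ → Task → ℕ → Tree Task → Tree Task
skipRow remaining (k , st) n acc with k ≤? remaining
... | yes _ = insertTree compareTask (k , st) n acc
... | no _ = acc

takeRow : List Bool → Task → ℕ → Tree Task → Tree Task
takeRow r (zero , st) n acc = acc
takeRow r (suc k , st) n acc = insertTree compareTask (k , absorb r st) n acc

advance : List Bool → ℕ → Task → ℕ → Tree Task → Tree Task
advance r remaining task n = takeRow r task n ∘ skipRow remaining task n

step : List Bool → ℕ → Tree Task → Tree Task
step r remaining t = foldTree (advance r remaining) t leaf

run : List (List Bool) → Tree Task → Tree Task
run [] t = t
run (r ∷ rs) t = run rs (step r (length rs) t)

module _ (q : ℕ → Bool) where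

  weighTree-skipRow : ∀ rs task n acc →
    weighTree (completions q rs) (skipRow (length rs) task n acc)
      ≡ n * completions q rs task + weighTree (completions q rs) acc
  weighTree-skipRow rs (k , st) n acc with k ≤? length rs
  ... | yes _ = weighTree-insertTree compareTask (completions q rs) (k , st) n acc
  ... | no k≰|rs| = begin
    weighTree (completions q rs) acc
      ≡⟨ cong (_+ weighTree (completions q rs) acc) (sym (*-zeroʳ n)) ⟩
    n * 0 + weighTree (completions q rs) acc
      ≡⟨ cong (λ W → n * countᵇ (q ∘ value st) W + weighTree (completions q rs) acc)
              (sym (length<⇒subsetsOfSize≡[] k rs (≰⇒> k≰|rs|))) ⟩
    n * completions q rs (k , st) + weighTree (completions q rs) acc ∎

  weighTree-advance : ∀ r rs task n acc →
    weighTree (completions q rs) (advance r (length rs) task n acc)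
      ≡ n * completions q (r ∷ rs) task + weighTree (completions q rs) acc
  weighTree-advance r rs (zero , st) n acc = weighTree-skipRow rs (zero , st) n acc
  weighTree-advance r rs (suc k , st) n acc = begin
    weighTree (completions q rs) (insertTree compareTask (k , absorb r st) n skipping)
      ≡⟨ weighTree-insertTree compareTask (completions q rs) (k , absorb r st) n skipping ⟩
    n * taken + weighTree (completions q rs) skipping
      ≡⟨ cong (n * taken +_) (weighTree-skipRow rs (suc k , st) n acc) ⟩
    n * taken + (n * skipped + weighTree (completions q rs) acc)
      ≡⟨ sym (+-assoc (n * taken) (n * skipped) _) ⟩
    n * taken + n * skipped + weighTree (completions q rs) acc
      ≡⟨ cong (_+ weighTree (completions q rs) acc)
              (trans (sym (*-distribˡ-+ n taken skipped))
                     (cong (n *_) (sym (completions-∷ q r rs k st)))) ⟩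
    n * completions q (r ∷ rs) (suc k , st) + weighTree (completions q rs) acc ∎
    where
    skipping : Tree Task
    skipping = skipRow (length rs) (suc k , st) n acc
    taken skipped : ℕ
    taken = completions q rs (k , absorb r st)
    skipped = completions q rs (suc k , st)

  weighTree-step : ∀ r rs t →
    weighTree (completions q rs) (step r (length rs) t) ≡ weighTree (completions q (r ∷ rs)) t
  weighTree-step r rs t =
    trans (foldTree-weigh (advance r (length rs)) (weighTree (completions q rs)) (completions q (r ∷ rs))
                          (weighTree-advance r rs) t leaf)
          (+-identityʳ _)

  weighTree-run : ∀ rs t → weighTree (completions q rs) t ≡ weighTree (completions q []) (run rs t)
  weighTree-run [] t = refl
  weighTree-run (r ∷ rs) t = trans (sym (weighTree-step r rs t)) (weighTree-run rs (step r (length rs) t))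

tally : Task → ℕ → Weighted ℕ → Weighted ℕ
tally (zero , st) n hist = insertWeighted compareℕ (value st []) n hist
tally (suc _ , _) _ hist = hist

histogram : Tree Task → Weighted ℕ
histogram t = foldTree tally t []

indicator : (ℕ → Bool) → ℕ → ℕ
indicator q v = if q v then 1 else 0

weigh-histogram : ∀ q t → weigh (indicator q) (histogram t) ≡ weighTree (completions q []) t
weigh-histogram q t =
  trans (foldTree-weigh tally (weigh (indicator q)) (completions q []) weigh-tally t []) (+-identityʳ _)
  where
  weigh-tally : ∀ task n hist →
    weigh (indicator q) (tally task n hist) ≡ n * completions q [] task + weigh (indicator q) hist
  weigh-tally (zero , st) n hist = weigh-insertWeighted compareℕ (indicator q) (value st []) n hist
  weigh-tally (suc _ , _) n hist = cong (_+ weigh (indicator q) hist) (sym (*-zeroʳ n))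

allFree : List Bool
allFree = replicate 8 true

start : Tree Task
start = node leaf (8 , (allFree , 1) ∷ []) 1 leaf

countᵇ-permanent : ∀ q rs →
  countᵇ (q ∘ permanent allFree) (subsetsOfSize 8 rs) ≡ weigh (indicator q) (histogram (run rs start))
countᵇ-permanent q rs = begin
  countᵇ (q ∘ permanent allFree) (subsetsOfSize 8 rs)
    ≡⟨ countᵇ-cong (λ W → cong q (sym (1*x+0≡x (permanent allFree W)))) (subsetsOfSize 8 rs) ⟩
  completions q rs (8 , (allFree , 1) ∷ [])
    ≡⟨ sym (1*x+0≡x _) ⟩
  weighTree (completions q rs) start
    ≡⟨ weighTree-run q rs start ⟩
  weighTree (completions q []) (run rs start)
    ≡⟨ sym (weigh-histogram q (run rs start)) ⟩
  weigh (indicator q) (histogram (run rs start)) ∎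
  where
  1*x+0≡x : ∀ x → 1 * x + 0 ≡ x
  1*x+0≡x x = trans (+-identityʳ (1 * x)) (*-identityˡ x)

cornerRow : List ℕ → List ℕ → List Bool
cornerRow S cs = map (λ s → does (s ∈? cs)) S

matchings≡permanent : ∀ S av W →
  matchings (select av S) W ≡ permanent av (map (cornerRow S ∘ cornerNumbers) W)
matchings≡permanent S av [] = refl
matchings≡permanent S av (C ∷ W) =
  trans (sum-picks-select (λ s → does (s ∈? cornerNumbers C)) (λ S′ → matchings S′ W) _
                          (λ _ _ → refl) av S)
        (sum-map-cong (λ av′ → matchings≡permanent S av′ W)
                      (choices av (cornerRow S (cornerNumbers C))))

solutionNumber≡permanent : ∀ T W →
  solutionNumber T W ≡ permanent allFree (map (cornerRow (cornerNumbers T) ∘ cornerNumbers) W)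
solutionNumber≡permanent T = matchings≡permanent (cornerNumbers T) allFree

countᵇ-solutionNumber-↭ : ∀ T cubes rows →
  map (cornerRow (cornerNumbers T) ∘ cornerNumbers) cubes ↭ rows → ∀ q →
  countᵇ (q ∘ solutionNumber T) (subsetsOfSize 8 cubes)
    ≡ countᵇ (q ∘ permanent allFree) (subsetsOfSize 8 rows)
countᵇ-solutionNumber-↭ T cubes rows cubes↭rows q = begin
  countᵇ (q ∘ solutionNumber T) (subsetsOfSize 8 cubes)
    ≡⟨ countᵇ-cong (cong q ∘ solutionNumber≡permanent T) (subsetsOfSize 8 cubes) ⟩
  countᵇ ((q ∘ permanent allFree) ∘ map row) (subsetsOfSize 8 cubes)
    ≡⟨ sym (countᵇ-subsetsOfSize-map row (q ∘ permanent allFree) 8 cubes) ⟩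
  countᵇ (q ∘ permanent allFree) (subsetsOfSize 8 (map row cubes))
    ≡⟨ ↭⇒sameSubsetCounts cubes↭rows 8 (q ∘ permanent allFree)
                          (λ W↭W′ → cong q (permanent-↭ W↭W′ allFree)) ⟩
  countᵇ (q ∘ permanent allFree) (subsetsOfSize 8 rows) ∎
  where
  row : Coloring → List Bool
  row = cornerRow (cornerNumbers T) ∘ cornerNumbers

cubeList : List Coloring
cubeList = (# 0 ∷ # 1 ∷ # 2 ∷ # 3 ∷ # 4 ∷ # 5 ∷ []) ∷
  (# 0 ∷ # 1 ∷ # 2 ∷ # 3 ∷ # 5 ∷ # 4 ∷ []) ∷
  (# 0 ∷ # 1 ∷ # 2 ∷ # 4 ∷ # 3 ∷ # 5 ∷ []) ∷
  (# 0 ∷ # 1 ∷ # 2 ∷ # 4 ∷ # 5 ∷ # 3 ∷ []) ∷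
  (# 0 ∷ # 1 ∷ # 2 ∷ # 5 ∷ # 3 ∷ # 4 ∷ []) ∷
  (# 0 ∷ # 1 ∷ # 2 ∷ # 5 ∷ # 4 ∷ # 3 ∷ []) ∷
  (# 0 ∷ # 2 ∷ # 1 ∷ # 3 ∷ # 4 ∷ # 5 ∷ []) ∷
  (# 0 ∷ # 2 ∷ # 1 ∷ # 3 ∷ # 5 ∷ # 4 ∷ []) ∷
  (# 0 ∷ # 2 ∷ # 1 ∷ # 4 ∷ # 3 ∷ # 5 ∷ []) ∷
  (# 0 ∷ # 2 ∷ # 1 ∷ # 4 ∷ # 5 ∷ # 3 ∷ []) ∷
  (# 0 ∷ # 2 ∷ # 1 ∷ # 5 ∷ # 3 ∷ # 4 ∷ []) ∷
  (# 0 ∷ # 2 ∷ # 1 ∷ # 5 ∷ # 4 ∷ # 3 ∷ []) ∷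
  (# 0 ∷ # 3 ∷ # 1 ∷ # 2 ∷ # 4 ∷ # 5 ∷ []) ∷
  (# 0 ∷ # 3 ∷ # 1 ∷ # 2 ∷ # 5 ∷ # 4 ∷ []) ∷
  (# 0 ∷ # 3 ∷ # 1 ∷ # 4 ∷ # 2 ∷ # 5 ∷ []) ∷
  (# 0 ∷ # 3 ∷ # 1 ∷ # 4 ∷ # 5 ∷ # 2 ∷ []) ∷
  (# 0 ∷ # 3 ∷ # 1 ∷ # 5 ∷ # 2 ∷ # 4 ∷ []) ∷
  (# 0 ∷ # 3 ∷ # 1 ∷ # 5 ∷ # 4 ∷ # 2 ∷ []) ∷
  (# 0 ∷ # 4 ∷ # 1 ∷ # 2 ∷ # 3 ∷ # 5 ∷ []) ∷
  (# 0 ∷ # 4 ∷ # 1 ∷ # 2 ∷ # 5 ∷ # 3 ∷ []) ∷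
  (# 0 ∷ # 4 ∷ # 1 ∷ # 3 ∷ # 2 ∷ # 5 ∷ []) ∷
  (# 0 ∷ # 4 ∷ # 1 ∷ # 3 ∷ # 5 ∷ # 2 ∷ []) ∷
  (# 0 ∷ # 4 ∷ # 1 ∷ # 5 ∷ # 2 ∷ # 3 ∷ []) ∷
  (# 0 ∷ # 4 ∷ # 1 ∷ # 5 ∷ # 3 ∷ # 2 ∷ []) ∷
  (# 0 ∷ # 5 ∷ # 1 ∷ # 2 ∷ # 3 ∷ # 4 ∷ []) ∷
  (# 0 ∷ # 5 ∷ # 1 ∷ # 2 ∷ # 4 ∷ # 3 ∷ []) ∷
  (# 0 ∷ # 5 ∷ # 1 ∷ # 3 ∷ # 2 ∷ # 4 ∷ []) ∷
  (# 0 ∷ # 5 ∷ # 1 ∷ # 3 ∷ # 4 ∷ # 2 ∷ []) ∷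
  (# 0 ∷ # 5 ∷ # 1 ∷ # 4 ∷ # 2 ∷ # 3 ∷ []) ∷
  (# 0 ∷ # 5 ∷ # 1 ∷ # 4 ∷ # 3 ∷ # 2 ∷ []) ∷ []

macMahonCubes≡cubeList : macMahonCubes ≡ cubeList
macMahonCubes≡cubeList = refl

cornerRows : Coloring → List (List Bool)
cornerRows T = map (cornerRow (cornerNumbers T) ∘ cornerNumbers) cubeList

referenceRows : List (List Bool)
referenceRows = sort (cornerRows (# 0 ∷ # 1 ∷ # 2 ∷ # 3 ∷ # 4 ∷ # 5 ∷ []))

sameSortedRows? : (R : List (List Bool)) → Dec (All (λ T → sort (cornerRows T) ≡ R) cubeList)
sameSortedRows? R = All.all? (λ T → ≡-dec (≡-dec Bool._≟_) (sort (cornerRows T)) R) cubeList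

cornerRows-↭ : ∀ {T} → T ∈ macMahonCubes → cornerRows T ↭ referenceRows
cornerRows-↭ {T} T∈ =
  ↭-trans (↭-sym (sort-↭ (cornerRows T)))
          (↭-reflexive (All.lookup sortedRows (subst (T ∈_) macMahonCubes≡cubeList T∈)))
  where
  -- Passing referenceRows as an argument makes Agda compute it once rather than 30 times.
  sortedRows : All (λ T → sort (cornerRows T) ≡ referenceRows) cubeList
  sortedRows = toWitness {a? = sameSortedRows? referenceRows} _

distribution : Weighted ℕ
distribution =
  (0 , 5719245) ∷ (2 , 93000) ∷ (4 , 15987) ∷ (6 , 2664) ∷
  (8 , 19860) ∷ (10 , 792) ∷ (12 , 1296) ∷ (16 , 81) ∷ []

histogram-referenceRows : histogram (run referenceRows start) ≡ distribution
histogram-referenceRows = refl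

-- Below, implicit arguments next to `collections` and `histogram (run …)` are given
-- explicitly: left to unification, Agda would start normalising these huge terms.
collections≡cubeSubsets : collections ≡ subsetsOfSize 8 cubeList
collections≡cubeSubsets = cong (subsetsOfSize 8) {x = macMahonCubes} {y = cubeList} macMahonCubes≡cubeList

countᵇ-solutionNumber : ∀ {T} → T ∈ macMahonCubes → (q : ℕ → Bool) →
  countᵇ (q ∘ solutionNumber T) collections ≡ weigh (indicator q) distribution
countᵇ-solutionNumber {T} T∈ q = begin
  countᵇ (q ∘ solutionNumber T) collections
    ≡⟨ cong (countᵇ (q ∘ solutionNumber T)) {x = collections} {y = subsetsOfSize 8 cubeList}
            collections≡cubeSubsets ⟩
  countᵇ (q ∘ solutionNumber T) (subsetsOfSize 8 cubeList)
    ≡⟨ countᵇ-solutionNumber-↭ T cubeList referenceRows (cornerRows-↭ T∈) q ⟩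
  countᵇ (q ∘ permanent allFree) (subsetsOfSize 8 referenceRows)
    ≡⟨ countᵇ-permanent q referenceRows ⟩
  weigh (indicator q) (histogram (run referenceRows start))
    ≡⟨ cong (weigh (indicator q)) {x = histogram (run referenceRows start)} {y = distribution}
            histogram-referenceRows ⟩
  weigh (indicator q) distribution ∎

count-solutionNumber : ∀ {T} → T ∈ macMahonCubes → {P : ℕ → Set} (P? : Decidable P) →
  count (λ W → P? (solutionNumber T W)) collections ≡ weigh (indicator (λ n → does (P? n))) distribution
count-solutionNumber {T} T∈ P? =
  trans (count≡countᵇ (λ W → P? (solutionNumber T W)) collections)
        (countᵇ-solutionNumber T∈ (λ n → does (P? n)))

theorem1 : (T : Coloring) → T ∈ macMahonCubes →
    length macMahonCubes ≡ 30
    × length collections ≡ 5852925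
    × count (λ W → 0 <? solutionNumber T W) collections ≡ 133680
    × All (λ W → solutionNumber T W ≤ 16) collections
    × count (λ W → solutionNumber T W ≟ 16) collections ≡ 81
    × All (λ W → 0 < solutionNumber T W → 2 ≤ solutionNumber T W) collections
    × count (λ W → solutionNumber T W ≟ 2) collections ≡ 93000
theorem1 T T∈ =
    cubeCount
  , trans (cong length {x = collections} {y = subsetsOfSize 8 cubeList} collections≡cubeSubsets)
          (length-subsetsOfSize 8 cubeList)
  , count-solutionNumber T∈ (0 <?_)
  , All.map ≮⇒≥ {collections}
      (count≡0⇒All∁ (λ W → 16 <? solutionNumber T W) {collections}
                    (count-solutionNumber T∈ (16 <?_)))
  , count-solutionNumber T∈ (_≟ 16)
  , All.map (λ ≢1 0< → ≤∧≢⇒< 0< (≢1 ∘ sym)) {collections}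
      (count≡0⇒All∁ (λ W → solutionNumber T W ≟ 1) {collections}
                    (count-solutionNumber T∈ (_≟ 1)))
  , count-solutionNumber T∈ (_≟ 2)
  where
  cubeCount : length macMahonCubes ≡ 30
  cubeCount = cong length {x = macMahonCubes} {y = cubeList} macMahonCubes≡cubeList
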